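{- Let $G=(K,I,E)$ be a split graph with split partition into a clique $K$ and a stable set $I$. The following are equivalent: (i) $G$ contains no induced subgraph isomorphic to $S_3$, $\overline{S_3}$, the rising sun, or the co-rising sun; (ii) $bip(G)$ contains no induced $3K_2$, $C_6$ or $P_7$; (iii) $bip(G)$ is an ACB graph with no induced $P_7$.
   Context: For a split graph $G=(K,I,E)$, $bip(G)=(K,I,E')$ is the bipartite graph with color classes $K$ and $I$ and edge set $E'=\{xy: x\in K, y\in I, xy\in E\}$ (i.e., the edges inside $K$ are removed). For $k\ge3$ the $k$-sun $S_k$ consists of a clique $q_0,\dots,q_{k-1}$ and a stable set $s_0,\dots,s_{k-1}$ with each $s_i$ adjacent exactly to $q_i,q_{i+1}$ (indices mod $k$); $\overline{S_3}$ is the complement of $S_3$. The rising sun is the graph obtained from $S_4$ by deleting one of the vertices $s_i$; the co-rising sun is its complement. For a bipartite graph $B=(X,Y,E)$, the mirror $mir(B)$ has the same color classes and $xy$ ($x\in X,y\in Y$) is an edge iff not an edge of $B$; $B$ is chordal bipartite if it has no induced chordless cycle $C_{2k}$, $k\ge3$; $B$ is ACB if $B$ and $mir(B)$ are chordal bipartite. $3K_2$: three disjoint edges; $C_6$: chordless 6-cycle; $P_7$: chordless path on 7 vertices. -}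

module Defs where

open import Data.Nat using (ℕ; zero; suc; _≡ᵇ_; _≤_; _*_)
open import Data.Bool using (Bool; true; false; _∧_; _∨_; not; _xor_)
open import Data.Fin using (Fin; toℕ)
open import Data.List using (List; []; _∷_)
open import Data.Bool.ListAction using (any)
open import Data.Product using (Σ; _×_; _,_)
open import Function.Definitions using (Injective)
open import Relation.Binary.PropositionalEquality using (_≡_; _≢_)
open import Relation.Nullary using (¬_)

Adjacency : ℕ → Set
Adjacency n = Fin n → Fin n → Bool

record Graph : Set where
  field
    n      : ℕ
    adj    : Adjacency n
    sym    : ∀ u v → adj u v ≡ adj v u
    irrefl : ∀ u → adj u u ≡ false

record SplitGraph : Set where
  field
    graph  : Graph
  open Graph graph public
  field
    inK    : Fin n → Bool
    clique : ∀ u v → u ≢ v → inK u ≡ true → inK v ≡ true → adj u v ≡ true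
    stable : ∀ u v → inK u ≡ false → inK v ≡ false → adj u v ≡ false

InducedIn : (m : ℕ) → Adjacency m → (n : ℕ) → Adjacency n → Set
InducedIn m h n g =
  Σ (Fin m → Fin n) λ f →
    Injective _≡_ _≡_ f × (∀ i j → h i j ≡ g (f i) (f j))

Free : (m : ℕ) → Adjacency m → (n : ℕ) → Adjacency n → Set
Free m h n g = ¬ InducedIn m h n g

fromEdges : (m : ℕ) → List (ℕ × ℕ) → Adjacency m
fromEdges m es i j =
  any (λ { (a , b) → ((a ≡ᵇ toℕ i) ∧ (b ≡ᵇ toℕ j)) ∨ ((a ≡ᵇ toℕ j) ∧ (b ≡ᵇ toℕ i)) }) es

complement : (m : ℕ) → Adjacency m → Adjacency m
complement m h i j = not (h i j) ∧ not (toℕ i ≡ᵇ toℕ j)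

-- S3: clique q0,q1,q2 = 0,1,2; stable s0,s1,s2 = 3,4,5; s_i ~ q_i, q_{i+1}.
S₃ : Adjacency 6
S₃ = fromEdges 6 ((0 , 1) ∷ (0 , 2) ∷ (1 , 2) ∷
                  (3 , 0) ∷ (3 , 1) ∷ (4 , 1) ∷ (4 , 2) ∷ (5 , 2) ∷ (5 , 0) ∷ [])

coS₃ : Adjacency 6
coS₃ = complement 6 S₃

-- Rising sun: S4 (clique q0..q3 = 0..3, s_i = 4+i) with s3 deleted.
risingSun : Adjacency 7
risingSun = fromEdges 7 ((0 , 1) ∷ (0 , 2) ∷ (0 , 3) ∷ (1 , 2) ∷ (1 , 3) ∷ (2 , 3) ∷
                         (4 , 0) ∷ (4 , 1) ∷ (5 , 1) ∷ (5 , 2) ∷ (6 , 2) ∷ (6 , 3) ∷ [])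

coRisingSun : Adjacency 7
coRisingSun = complement 7 risingSun

threeK₂ : Adjacency 6
threeK₂ = fromEdges 6 ((0 , 1) ∷ (2 , 3) ∷ (4 , 5) ∷ [])

pathAdj : (k : ℕ) → Adjacency k
pathAdj k i j = (suc (toℕ i) ≡ᵇ toℕ j) ∨ (suc (toℕ j) ≡ᵇ toℕ i)

-- Chordless cycle on k vertices (meaningful for k ≥ 3): i ~ i+1 mod k.
cycleAdj : (k : ℕ) → Adjacency k
cycleAdj k i j =
  pathAdj k i j
  ∨ ((toℕ i ≡ᵇ 0) ∧ (suc (toℕ j) ≡ᵇ k))
  ∨ ((toℕ j ≡ᵇ 0) ∧ (suc (toℕ i) ≡ᵇ k))

P₇ : Adjacency 7
P₇ = pathAdj 7

C₆ : Adjacency 6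
C₆ = cycleAdj 6

-- Bipartite graphs with color classes given by a side function
-- (side v ≡ true: v ∈ X, otherwise v ∈ Y).
-- Chordal bipartite: no induced chordless cycle C_{2k} with k ≥ 3.
ChordalBipartite : (n : ℕ) → Adjacency n → Set
ChordalBipartite n b = ∀ k → 3 ≤ k → Free (2 * k) (cycleAdj (2 * k)) n b

mirror : (n : ℕ) → (Fin n → Bool) → Adjacency n → Adjacency n
mirror n side b u v = (side u xor side v) ∧ not (b u v)

ACB : (n : ℕ) → (Fin n → Bool) → Adjacency n → Set
ACB n side b = ChordalBipartite n b × ChordalBipartite n (mirror n side b)

bip : (G : SplitGraph) → Adjacency (SplitGraph.n G)
bip G u v = (inK u xor inK v) ∧ adj u v
  where open SplitGraph G

module Submission where

-- Every statement in Proposition 10 has the form "if the big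
-- graph contains an induced copy of some small graph H, it contains an
-- induced copy of some small graph P", between G, bip(G) and mir(bip(G)).
-- An induced copy f of H determines the colouring c = inK ∘ f of H
-- (which vertices of the copy lie in K), and the copy of H in one of the
-- three graphs is an induced copy, via the same f, of a small graph built
-- from H and c alone in another one:
--   * a copy of H in G is a copy of crossing c H in bip(G), and c is a
--     split colouring of H;
--   * a copy of H in bip(G) is a copy of splitCompletion c H in G;
--   * copies of H in bip(G) and in mir(bip(G)) are copies of mirror c H
--     in the other graph,
-- where in the last two cases every edge of H crosses the colouring.
-- Since H has at most 8 vertices, "for every admissible colouring c the
-- small graph built from H and c contains P" is a finite fact, decided
-- by enumerating all colourings and checking explicit candidate
-- embeddings.  Composing induced embeddings transfers P to the big graph.
-- Chordlessness of the long cycles C_{2k}, k ≥ 4 (resp. k ≥ 5 in the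
-- mirror) reduces to the short cases because a long cycle contains an
-- induced P₇ (resp. P₈) as an initial segment.

open import Defs
open import Data.Product using (_×_)
open import Function.Bundles using (_⇔_)

open import Data.Nat using (zero; suc; _<_; _≤_; _*_; _≡ᵇ_; z≤n; s≤s)
import Data.Nat.Properties as ℕ
open import Data.Bool using (Bool; true; false; _∧_; not; _xor_; if_then_else_)
open import Data.Bool.Properties using (∧-zeroʳ; ∨-identityʳ) renaming (_≟_ to _≟ᵇ_)
open import Data.Fin using (Fin; toℕ; inject≤; #_)
open import Data.Fin.Properties using (_≟_; all?; toℕ-inject≤; inject≤-injective; toℕ<n)
open import Data.Vec using (Vec; []; _∷_; lookup; tabulate)
open import Data.Vec.Properties using (lookup∘tabulate)
open import Data.List using (List; []; _∷_)
open import Data.List.Relation.Unary.Any using (Any; any?; satisfied)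
open import Data.Product using (_,_; proj₁; proj₂)
open import Data.Sum using (_⊎_)
import Data.Sum as Sum
open import Function using (_∘_)
open import Function.Bundles using (mk⇔)
open import Relation.Binary.PropositionalEquality
  using (_≡_; _≢_; refl; sym; trans; cong; cong₂)
open import Relation.Nullary using (Dec; does; yes; no)
open import Relation.Nullary.Decidable
  using (True; toWitness; map′; dec-false; _×-dec_; _→-dec_; _⊎-dec_; ¬?)

∘-induced : ∀ {m k n} {H : Adjacency m} {X : Adjacency k} {A : Adjacency n} →
  InducedIn k X n A → InducedIn m H k X → InducedIn m H n A
∘-induced (g , g-inj , g-adj) (f , f-inj , f-adj) =
  g ∘ f , f-inj ∘ g-inj , λ i j → trans (f-adj i j) (g-adj (f i) (f j))

retarget : ∀ {m n} {H : Adjacency m} {A A′ : Adjacency n} →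
  (∀ u v → A u v ≡ A′ u v) → InducedIn m H n A → InducedIn m H n A′
retarget A≗A′ (f , f-inj , f-adj) = f , f-inj , λ i j → trans (f-adj i j) (A≗A′ (f i) (f j))

-- IsInducedEmbedding H X σ: the map σ is an induced embedding of H into X,
-- stated pairwise so that it can be decided by evaluation.
IsInducedEmbedding : ∀ {m k} → Adjacency m → Adjacency k → (Fin m → Fin k) → Set
IsInducedEmbedding H X σ = ∀ i j → (σ i ≡ σ j → i ≡ j) × H i j ≡ X (σ i) (σ j)

isInducedEmbedding? : ∀ {m k} (H : Adjacency m) (X : Adjacency k) σ →
  Dec (IsInducedEmbedding H X σ)
isInducedEmbedding? H X σ = all? λ i → all? λ j →
  ((σ i ≟ σ j) →-dec (i ≟ j)) ×-dec (H i j ≟ᵇ X (σ i) (σ j))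

Certifies : ∀ {m k} → List (Vec (Fin k) m) → Adjacency m → Adjacency k → Set
Certifies cs H X = Any (IsInducedEmbedding H X ∘ lookup) cs

certifies? : ∀ {m k} (cs : List (Vec (Fin k) m)) (H : Adjacency m) (X : Adjacency k) →
  Dec (Certifies cs H X)
certifies? cs H X = any? (isInducedEmbedding? H X ∘ lookup) cs

certified : ∀ {m k} {cs : List (Vec (Fin k) m)} {H : Adjacency m} {X : Adjacency k} →
  Certifies cs H X → InducedIn m H k X
certified cert with satisfied cert
... | p , emb = lookup p , (λ {i} {j} → proj₁ (emb i j)) , (λ i j → proj₂ (emb i j))

every? : ∀ {m} {P : Vec Bool m → Set} → (∀ v → Dec (P v)) → Dec (∀ v → P v)
every? {zero} P? = map′ (λ { p [] → p }) (λ p → p []) (P? [])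
every? {suc m} P? =
  map′ (λ { (t , f) (true ∷ v) → t v ; (t , f) (false ∷ v) → f v })
       (λ p → p ∘ (true ∷_) , p ∘ (false ∷_))
       (every? (P? ∘ (true ∷_)) ×-dec every? (P? ∘ (false ∷_)))

-- The edges of A joining the two colour classes of s.  Both bip(G) and
-- mirrors are of this form: bip G = crossing inK adj, and
-- mirror n s B = crossing s (not of B).
crossing : ∀ {n} → (Fin n → Bool) → Adjacency n → Adjacency n
crossing s A u v = (s u xor s v) ∧ A u v

Crossing : ∀ {m} → (Fin m → Bool) → Adjacency m → Set
Crossing c H = ∀ a b → H a b ≡ true → (c a xor c b) ≡ true

crossing? : ∀ {m} (c : Fin m → Bool) (H : Adjacency m) → Dec (Crossing c H)
crossing? c H = all? λ a → all? λ b → (H a b ≟ᵇ true) →-dec ((c a xor c b) ≟ᵇ true)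

SplitColouring : ∀ {m} → (Fin m → Bool) → Adjacency m → Set
SplitColouring c H =
  (∀ a b → a ≢ b → c a ≡ true → c b ≡ true → H a b ≡ true) ×
  (∀ a b → c a ≡ false → c b ≡ false → H a b ≡ false)

splitColouring? : ∀ {m} (c : Fin m → Bool) (H : Adjacency m) → Dec (SplitColouring c H)
splitColouring? c H =
  (all? λ a → all? λ b →
     ¬? (a ≟ b) →-dec ((c a ≟ᵇ true) →-dec ((c b ≟ᵇ true) →-dec (H a b ≟ᵇ true))))
  ×-dec
  (all? λ a → all? λ b →
     (c a ≟ᵇ false) →-dec ((c b ≟ᵇ false) →-dec (H a b ≟ᵇ false)))

splitCompletion : ∀ {m} → (Fin m → Bool) → Adjacency m → Adjacency m
splitCompletion c H a b = if c a xor c b then H a b else c a ∧ not (does (a ≟ b))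

-- The colouring of the vertices of a copy f inherited from a colouring s
-- of the big graph.  It is stored as a vector, so that facts established
-- by enumerating all vectors apply to it.
inherited : ∀ {m n} → (Fin n → Bool) → (Fin m → Fin n) → Vec Bool m
inherited s f = tabulate (s ∘ f)

inherited-spec : ∀ {m n} (s : Fin n → Bool) (f : Fin m → Fin n) a →
  lookup (inherited s f) a ≡ s (f a)
inherited-spec s f = lookup∘tabulate (s ∘ f)

crossing-pullback : ∀ {m n} (s : Fin n → Bool) {H : Adjacency m} {A : Adjacency n}
  (f : Fin m → Fin n) → (∀ a b → H a b ≡ A (f a) (f b)) →
  ∀ a b → crossing (lookup (inherited s f)) H a b ≡ crossing s A (f a) (f b)
crossing-pullback s f f-adj a b =
  cong₂ _∧_ (cong₂ _xor_ (inherited-spec s f a) (inherited-spec s f b)) (f-adj a b)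

crossing-restrict : ∀ {m n} (s : Fin n → Bool) {H : Adjacency m} {A : Adjacency n} →
  (e : InducedIn m H n A) →
  InducedIn m (crossing (lookup (inherited s (proj₁ e))) H) n (crossing s A)
crossing-restrict s {A = A} (f , f-inj , f-adj) = f , f-inj , crossing-pullback s {A = A} f f-adj

mirror-restrict : ∀ {m n} (s : Fin n → Bool) {H : Adjacency m} {B : Adjacency n} →
  (e : InducedIn m H n B) →
  InducedIn m (mirror m (lookup (inherited s (proj₁ e))) H) n (mirror n s B)
mirror-restrict s {B = B} (f , f-inj , f-adj) =
  f , f-inj , crossing-pullback s {A = λ u v → not (B u v)} f (λ a b → cong not (f-adj a b))

restrict-crosses : ∀ {m n} (s : Fin n → Bool) {H : Adjacency m} {A : Adjacency n} →
  (e : InducedIn m H n (crossing s A)) → Crossing (lookup (inherited s (proj₁ e))) H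
restrict-crosses s (f , f-inj , f-adj) a b Hab =
  trans (cong₂ _xor_ (inherited-spec s f a) (inherited-spec s f b))
        (first-conjunct (trans (sym (f-adj a b)) Hab))
  where
  first-conjunct : ∀ {x y} → x ∧ y ≡ true → x ≡ true
  first-conjunct {true} _ = refl

mirror-involutive : ∀ {n} (s : Fin n → Bool) (B : Adjacency n) u v →
  mirror n s (mirror n s B) u v ≡ crossing s B u v
mirror-involutive s B u v with s u xor s v | B u v
... | true  | true  = refl
... | true  | false = refl
... | false | _     = refl

mirror-back : ∀ {m n} (s : Fin n → Bool) {H : Adjacency m} {B : Adjacency n} →
  (e : InducedIn m H n (mirror n s B)) →
  InducedIn m (mirror m (lookup (inherited s (proj₁ e))) H) n (crossing s B)
mirror-back {n = n} s {B = B} e =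
  retarget {A = mirror n s (mirror n s B)} (mirror-involutive s B) (mirror-restrict s {B = mirror n s B} e)

initial-path : ∀ {k L} → k < L → InducedIn k (pathAdj k) L (cycleAdj L)
initial-path {k} {L} k<L =
  (λ i → inject≤ i (ℕ.<⇒≤ k<L)) ,
  (λ {i} {j} → inject≤-injective (ℕ.<⇒≤ k<L) (ℕ.<⇒≤ k<L) i j) ,
  same-adjacency
  where
  no-wrap : (j : Fin k) → (suc (toℕ j) ≡ᵇ L) ≡ false
  no-wrap j = dec-false (suc (toℕ j) ℕ.≟ L) (ℕ.<⇒≢ (ℕ.≤-<-trans (toℕ<n j) k<L))

  same-adjacency : ∀ i j →
    pathAdj k i j ≡ cycleAdj L (inject≤ i (ℕ.<⇒≤ k<L)) (inject≤ j (ℕ.<⇒≤ k<L))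
  same-adjacency i j
    rewrite toℕ-inject≤ i (ℕ.<⇒≤ k<L) | toℕ-inject≤ j (ℕ.<⇒≤ k<L)
          | no-wrap i | no-wrap j
          | ∧-zeroʳ (toℕ i ≡ᵇ 0) | ∧-zeroʳ (toℕ j ≡ᵇ 0)
    = sym (∨-identityʳ (pathAdj k i j))

cycle⇒path : ∀ {k L n} {A : Adjacency n} → k < L →
  InducedIn L (cycleAdj L) n A → InducedIn k (pathAdj k) n A
cycle⇒path {A = A} k<L c = ∘-induced {A = A} c (initial-path k<L)

-- The implicit argument is trivial exactly when the
-- enumeration succeeds.
byEnumeration : ∀ {m p k} {Cond : (Fin m → Bool) → Set} (cond? : ∀ c → Dec (Cond c))
  (P : Adjacency p) (L : (Fin m → Bool) → Adjacency k) (cs : List (Vec (Fin k) p)) →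
  {True (every? λ v → cond? (lookup v) →-dec certifies? cs P (L (lookup v)))} →
  ∀ v → Cond (lookup v) → InducedIn p P k (L (lookup v))
byEnumeration cond? P L cs {ok} v cond = certified {cs = cs} {P} {L (lookup v)} (toWitness ok v cond)

completion-of-3K₂ : ∀ v → Crossing (lookup v) threeK₂ →
  InducedIn 6 coS₃ 6 (splitCompletion (lookup v) threeK₂)
completion-of-3K₂ = byEnumeration (λ c → crossing? c threeK₂) coS₃ (λ c → splitCompletion c threeK₂)
  ((# 0 ∷ # 2 ∷ # 4 ∷ # 5 ∷ # 1 ∷ # 3 ∷ []) ∷ (# 0 ∷ # 2 ∷ # 5 ∷ # 4 ∷ # 1 ∷ # 3 ∷ []) ∷
   (# 0 ∷ # 3 ∷ # 4 ∷ # 5 ∷ # 1 ∷ # 2 ∷ []) ∷ (# 0 ∷ # 3 ∷ # 5 ∷ # 4 ∷ # 1 ∷ # 2 ∷ []) ∷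
   (# 1 ∷ # 2 ∷ # 4 ∷ # 5 ∷ # 0 ∷ # 3 ∷ []) ∷ (# 1 ∷ # 2 ∷ # 5 ∷ # 4 ∷ # 0 ∷ # 3 ∷ []) ∷
   (# 1 ∷ # 3 ∷ # 4 ∷ # 5 ∷ # 0 ∷ # 2 ∷ []) ∷ (# 1 ∷ # 3 ∷ # 5 ∷ # 4 ∷ # 0 ∷ # 2 ∷ []) ∷ [])

completion-of-C₆ : ∀ v → Crossing (lookup v) C₆ →
  InducedIn 6 S₃ 6 (splitCompletion (lookup v) C₆)
completion-of-C₆ = byEnumeration (λ c → crossing? c C₆) S₃ (λ c → splitCompletion c C₆)
  ((# 1 ∷ # 3 ∷ # 5 ∷ # 2 ∷ # 4 ∷ # 0 ∷ []) ∷ (# 0 ∷ # 2 ∷ # 4 ∷ # 1 ∷ # 3 ∷ # 5 ∷ []) ∷ [])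

-- A 2-coloured P₇ completes to a split graph containing the rising sun
-- (when its end vertices lie in the clique) or the co-rising sun.
completion-of-P₇ : ∀ v → Crossing (lookup v) P₇ →
  InducedIn 7 risingSun 7 (splitCompletion (lookup v) P₇) ⊎
  InducedIn 7 coRisingSun 7 (splitCompletion (lookup v) P₇)
completion-of-P₇ v crosses =
  Sum.map (certified {cs = rising} {risingSun} {X})
          (certified {cs = coRising} {coRisingSun} {X})
          (toWitness {a? = every? λ w → crossing? (lookup w) P₇ →-dec
                             (certifies? rising risingSun (splitCompletion (lookup w) P₇) ⊎-dec
                              certifies? coRising coRisingSun (splitCompletion (lookup w) P₇))}
                     _ v crosses)
  where
  X : Adjacency 7
  X = splitCompletion (lookup v) P₇
  rising coRising : List (Vec (Fin 7) 7)
  rising = (# 0 ∷ # 2 ∷ # 4 ∷ # 6 ∷ # 1 ∷ # 3 ∷ # 5 ∷ []) ∷ []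
  coRising = (# 2 ∷ # 0 ∷ # 6 ∷ # 4 ∷ # 5 ∷ # 3 ∷ # 1 ∷ []) ∷ []

crossing-of-S₃ : ∀ v → SplitColouring (lookup v) S₃ → InducedIn 6 C₆ 6 (crossing (lookup v) S₃)
crossing-of-S₃ = byEnumeration (λ c → splitColouring? c S₃) C₆ (λ c → crossing c S₃)
  ((# 0 ∷ # 3 ∷ # 1 ∷ # 4 ∷ # 2 ∷ # 5 ∷ []) ∷ [])

crossing-of-coS₃ : ∀ v → SplitColouring (lookup v) coS₃ →
  InducedIn 6 threeK₂ 6 (crossing (lookup v) coS₃)
crossing-of-coS₃ = byEnumeration (λ c → splitColouring? c coS₃) threeK₂ (λ c → crossing c coS₃)
  ((# 0 ∷ # 4 ∷ # 1 ∷ # 5 ∷ # 2 ∷ # 3 ∷ []) ∷ [])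

crossing-of-risingSun : ∀ v → SplitColouring (lookup v) risingSun →
  InducedIn 7 P₇ 7 (crossing (lookup v) risingSun)
crossing-of-risingSun =
  byEnumeration (λ c → splitColouring? c risingSun) P₇ (λ c → crossing c risingSun)
  ((# 0 ∷ # 4 ∷ # 1 ∷ # 5 ∷ # 2 ∷ # 6 ∷ # 3 ∷ []) ∷ [])

crossing-of-coRisingSun : ∀ v → SplitColouring (lookup v) coRisingSun →
  InducedIn 7 P₇ 7 (crossing (lookup v) coRisingSun)
crossing-of-coRisingSun =
  byEnumeration (λ c → splitColouring? c coRisingSun) P₇ (λ c → crossing c coRisingSun)
  ((# 1 ∷ # 6 ∷ # 0 ∷ # 5 ∷ # 3 ∷ # 4 ∷ # 2 ∷ []) ∷ [])

mirror-of-3K₂ : ∀ v → Crossing (lookup v) threeK₂ → InducedIn 6 C₆ 6 (mirror 6 (lookup v) threeK₂)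
mirror-of-3K₂ = byEnumeration (λ c → crossing? c threeK₂) C₆ (λ c → mirror 6 c threeK₂)
  ((# 0 ∷ # 3 ∷ # 4 ∷ # 1 ∷ # 2 ∷ # 5 ∷ []) ∷ (# 0 ∷ # 3 ∷ # 5 ∷ # 1 ∷ # 2 ∷ # 4 ∷ []) ∷
   (# 0 ∷ # 2 ∷ # 4 ∷ # 1 ∷ # 3 ∷ # 5 ∷ []) ∷ (# 0 ∷ # 2 ∷ # 5 ∷ # 1 ∷ # 3 ∷ # 4 ∷ []) ∷ [])

mirror-of-C₆ : ∀ v → Crossing (lookup v) C₆ → InducedIn 6 threeK₂ 6 (mirror 6 (lookup v) C₆)
mirror-of-C₆ = byEnumeration (λ c → crossing? c C₆) threeK₂ (λ c → mirror 6 c C₆)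
  ((# 0 ∷ # 3 ∷ # 1 ∷ # 4 ∷ # 2 ∷ # 5 ∷ []) ∷ [])

mirror-of-C₈ : ∀ v → Crossing (lookup v) (cycleAdj 8) →
  InducedIn 7 P₇ 8 (mirror 8 (lookup v) (cycleAdj 8))
mirror-of-C₈ = byEnumeration (λ c → crossing? c (cycleAdj 8)) P₇ (λ c → mirror 8 c (cycleAdj 8))
  ((# 0 ∷ # 3 ∷ # 6 ∷ # 1 ∷ # 4 ∷ # 7 ∷ # 2 ∷ []) ∷ [])

mirror-of-P₈ : ∀ v → Crossing (lookup v) (pathAdj 8) →
  InducedIn 6 C₆ 8 (mirror 8 (lookup v) (pathAdj 8))
mirror-of-P₈ = byEnumeration (λ c → crossing? c (pathAdj 8)) C₆ (λ c → mirror 8 c (pathAdj 8))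
  ((# 0 ∷ # 3 ∷ # 6 ∷ # 1 ∷ # 4 ∷ # 7 ∷ []) ∷ [])

-- A bipartite graph without induced C₆ and P₇ is chordal bipartite:
-- every longer cycle contains an induced P₇.
chordal-bipartite : ∀ {n} {B : Adjacency n} → Free 6 C₆ n B → Free 7 P₇ n B → ChordalBipartite n B
chordal-bipartite noC₆ noP₇ 1 (s≤s ())
chordal-bipartite noC₆ noP₇ 2 (s≤s (s≤s ()))
chordal-bipartite noC₆ noP₇ 3 _ = noC₆
chordal-bipartite {B = B} noC₆ noP₇ k@(suc (suc (suc (suc _)))) _ =
  noP₇ ∘ cycle⇒path {A = B} (ℕ.*-monoʳ-≤ 2 {4} {k} (s≤s (s≤s (s≤s (s≤s z≤n)))))

module Bipartite {n} (s : Fin n → Bool) (A : Adjacency n) where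

  B : Adjacency n
  B = crossing s A

  crossing-idempotent : ∀ u v → crossing s B u v ≡ B u v
  crossing-idempotent u v with s u xor s v
  ... | true  = refl
  ... | false = refl

  viaMirror : ∀ {m p} {H : Adjacency m} {P : Adjacency p} →
    (∀ v → Crossing (lookup v) H → InducedIn p P m (mirror m (lookup v) H)) →
    InducedIn m H n B → InducedIn p P n (mirror n s B)
  viaMirror local e =
    ∘-induced {A = mirror n s B} (mirror-restrict s {B = B} e)
      (local (inherited s (proj₁ e)) (restrict-crosses s {A = A} e))

  viaMirrorBack : ∀ {m p} {H : Adjacency m} {P : Adjacency p} →
    (∀ v → Crossing (lookup v) H → InducedIn p P m (mirror m (lookup v) H)) →
    InducedIn m H n (mirror n s B) → InducedIn p P n B
  viaMirrorBack local e =
    ∘-induced {A = B} (retarget {A = crossing s B} crossing-idempotent (mirror-back s {B = B} e))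
      (local (inherited s (proj₁ e)) (restrict-crosses s {A = λ u v → not (B u v)} e))

  -- mir(B) is chordal bipartite when B has no induced 3K₂, C₆ and P₇:
  -- a C₆, C₈ or long cycle in mir(B) yields a 3K₂, P₇ or C₆ in B.
  mirror-chordal : Free 6 threeK₂ n B → Free 6 C₆ n B → Free 7 P₇ n B →
    ChordalBipartite n (mirror n s B)
  mirror-chordal no3K₂ noC₆ noP₇ 1 (s≤s ())
  mirror-chordal no3K₂ noC₆ noP₇ 2 (s≤s (s≤s ()))
  mirror-chordal no3K₂ noC₆ noP₇ 3 _ = no3K₂ ∘ viaMirrorBack mirror-of-C₆
  mirror-chordal no3K₂ noC₆ noP₇ 4 _ = noP₇ ∘ viaMirrorBack mirror-of-C₈
  mirror-chordal no3K₂ noC₆ noP₇ k@(suc (suc (suc (suc (suc _))))) _ =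
    noC₆ ∘ viaMirrorBack mirror-of-P₈ ∘ cycle⇒path {A = mirror n s B} 9≤2k
    where
    9≤2k : 9 ≤ 2 * k
    9≤2k = ℕ.≤-trans (ℕ.n≤1+n 9) (ℕ.*-monoʳ-≤ 2 {5} {k} (s≤s (s≤s (s≤s (s≤s (s≤s z≤n))))))

module Split (G : SplitGraph) where
  open SplitGraph G hiding (sym)

  NoSunsInG : Set
  NoSunsInG = Free 6 S₃ n adj × Free 6 coS₃ n adj × Free 7 risingSun n adj × Free 7 coRisingSun n adj

  NoSmallInBip : Set
  NoSmallInBip = Free 6 threeK₂ n (bip G) × Free 6 C₆ n (bip G) × Free 7 P₇ n (bip G)

  ACBWithoutP₇ : Set
  ACBWithoutP₇ = ACB n inK (bip G) × Free 7 P₇ n (bip G)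

  split-colouring : ∀ {m} {H : Adjacency m} (e : InducedIn m H n adj) →
    SplitColouring (lookup (inherited inK (proj₁ e))) H
  split-colouring {H = H} (f , f-inj , f-adj) = in-clique , in-stable
    where
    K? : Fin _ → Bool
    K? = lookup (inherited inK f)

    in-clique : ∀ a b → a ≢ b → K? a ≡ true → K? b ≡ true → H a b ≡ true
    in-clique a b a≢b Ka Kb = trans (f-adj a b)
      (clique (f a) (f b) (a≢b ∘ f-inj)
              (trans (sym (inherited-spec inK f a)) Ka) (trans (sym (inherited-spec inK f b)) Kb))

    in-stable : ∀ a b → K? a ≡ false → K? b ≡ false → H a b ≡ false
    in-stable a b Ia Ib = trans (f-adj a b)
      (stable (f a) (f b) (trans (sym (inherited-spec inK f a)) Ia) (trans (sym (inherited-spec inK f b)) Ib))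

  split-restrict : ∀ {m} {H : Adjacency m} (e : InducedIn m H n (bip G)) →
    InducedIn m (splitCompletion (lookup (inherited inK (proj₁ e))) H) n adj
  split-restrict {H = H} (f , f-inj , f-adj) = f , f-inj , agrees
    where
    agrees : ∀ a b → splitCompletion (lookup (inherited inK f)) H a b ≡ adj (f a) (f b)
    agrees a b rewrite inherited-spec inK f a | inherited-spec inK f b
      with inK (f a) in Ka | inK (f b) in Kb | f-adj a b
    ... | true  | false | H≡adj = H≡adj
    ... | false | true  | H≡adj = H≡adj
    ... | false | false | _     = sym (stable (f a) (f b) Ka Kb)
    ... | true  | true  | _ with a ≟ b
    ...   | yes refl = sym (irrefl (f a))
    ...   | no a≢b   = sym (clique (f a) (f b) (a≢b ∘ f-inj) Ka Kb)

  viaBip : ∀ {m p} {H : Adjacency m} {P : Adjacency p} →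
    (∀ v → SplitColouring (lookup v) H → InducedIn p P m (crossing (lookup v) H)) →
    InducedIn m H n adj → InducedIn p P n (bip G)
  viaBip local e = ∘-induced {A = bip G} (crossing-restrict inK {A = adj} e)
    (local (inherited inK (proj₁ e)) (split-colouring e))

  viaCompletion : ∀ {m p} {H : Adjacency m} {P : Adjacency p} →
    (∀ v → Crossing (lookup v) H → InducedIn p P m (splitCompletion (lookup v) H)) →
    InducedIn m H n (bip G) → InducedIn p P n adj
  viaCompletion local e = ∘-induced {A = adj} (split-restrict e)
    (local (inherited inK (proj₁ e)) (restrict-crosses inK {A = adj} e))

  bip-P₇⇒sun : InducedIn 7 P₇ n (bip G) → InducedIn 7 risingSun n adj ⊎ InducedIn 7 coRisingSun n adj
  bip-P₇⇒sun e =
    Sum.map (∘-induced {A = adj} (split-restrict e)) (∘-induced {A = adj} (split-restrict e))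
    (completion-of-P₇ (inherited inK (proj₁ e)) (restrict-crosses inK {A = adj} e))

proposition10 : (G : SplitGraph) →
    let open SplitGraph G in
    ((Free 6 S₃ n adj × Free 6 coS₃ n adj × Free 7 risingSun n adj × Free 7 coRisingSun n adj)
    ⇔ (Free 6 threeK₂ n (bip G) × Free 6 C₆ n (bip G) × Free 7 P₇ n (bip G)))
    × ((Free 6 threeK₂ n (bip G) × Free 6 C₆ n (bip G) × Free 7 P₇ n (bip G))
    ⇔ (ACB n inK (bip G) × Free 7 P₇ n (bip G)))
proposition10 G = mk⇔ i⇒ii ii⇒i , mk⇔ ii⇒iii iii⇒ii
  where
  open SplitGraph G
  open Split G
  open Bipartite inK adj

  i⇒ii : NoSunsInG → NoSmallInBip
  i⇒ii (noS₃ , noCoS₃ , noRising , noCoRising) =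
    noCoS₃ ∘ viaCompletion completion-of-3K₂ ,
    noS₃ ∘ viaCompletion completion-of-C₆ ,
    Sum.[ noRising , noCoRising ] ∘ bip-P₇⇒sun

  ii⇒i : NoSmallInBip → NoSunsInG
  ii⇒i (no3K₂ , noC₆ , noP₇) =
    noC₆ ∘ viaBip crossing-of-S₃ , no3K₂ ∘ viaBip crossing-of-coS₃ ,
    noP₇ ∘ viaBip crossing-of-risingSun , noP₇ ∘ viaBip crossing-of-coRisingSun

  ii⇒iii : NoSmallInBip → ACBWithoutP₇
  ii⇒iii (no3K₂ , noC₆ , noP₇) =
    (chordal-bipartite {B = bip G} noC₆ noP₇ , mirror-chordal no3K₂ noC₆ noP₇) , noP₇

  iii⇒ii : ACBWithoutP₇ → NoSmallInBip
  iii⇒ii ((noLongCycle , noLongMirrorCycle) , noP₇) =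
    noLongMirrorCycle 3 ℕ.≤-refl ∘ viaMirror mirror-of-3K₂ , noLongCycle 3 ℕ.≤-refl , noP₇
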